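{- For every integer $\ell \geq 1$, $$\prod_{i=1}^{\ell} \left(1 + \frac{1}{p_i-1} \right) \leq p_{\ell+1}-1,$$ where $p_1=2<p_2=3<p_3<\cdots$ is the increasing enumeration of the prime numbers. -}

module Defs where

open import Data.Nat using (ℕ; zero; suc; _<_; _≤_; _∸_)
open import Data.Nat.Primality using (Prime)
open import Data.Integer using (+_)
open import Data.Rational using (ℚ; _/_; 1ℚ; 0ℚ; _+_; _*_)
open import Data.Product using (∃; _×_)
open import Relation.Binary.PropositionalEquality using (_≡_)

-- p is the increasing enumeration of the primes, 1-indexed: p 1 = 2, p 2 = 3, ...
-- (the value p 0 is irrelevant/unconstrained)
record IsPrimeEnumeration (p : ℕ → ℕ) : Set where
  field
    prime     : ∀ i → 1 ≤ i → Prime (p i)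
    strictMono : ∀ i j → 1 ≤ i → i < j → p i < p j
    complete  : ∀ q → Prime q → ∃ λ i → 1 ≤ i × p i ≡ q

-- 1 / (n - 1) as a rational, for n ≥ 2 (value 0 for n ∈ {0,1}; only used on primes)
invPred : ℕ → ℚ
invPred zero = 0ℚ
invPred (suc zero) = 0ℚ
invPred (suc (suc k)) = (+ 1) / suc k

prod1 : (ℕ → ℚ) → ℕ → ℚ
prod1 f zero = 1ℚ
prod1 f (suc ℓ) = prod1 f ℓ * f (suc ℓ)

-- Each factor is 1 + 1/(q − 1) = q/(q − 1), so multiplying a bound x ≤ q − 1 by it
-- gives x · (1 + 1/(q − 1)) ≤ q ≤ r − 1 for the next prime r > q.  Starting from the
-- empty product 1 ≤ p₁ − 1, induction bounds the product up to pₗ by pₗ₊₁ − 1; only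
-- pᵢ ≥ 2 and strict monotonicity of the enumeration are used.
module Submission where

open import Defs
open import Data.List using (_∷_; [])
open import Data.Nat using (ℕ; suc; _≤_; _<_; _∸_; z≤n; s≤s; nonTrivial⇒n>1)
open import Data.Nat.Primality using (prime⇒nonTrivial)
open import Data.Nat.Properties using (∸-monoˡ-≤; n<1+n)
open import Data.Nat.Tactic.RingSolver using (solve)
open import Data.Integer using (+_; +≤+)
import Data.Integer.Properties as ℤ
open import Data.Rational using (ℚ; 1ℚ; _+_; _*_; NonNegative; toℚᵘ)
  renaming (_≤_ to _≤ℚ_; _/_ to _/ℚ_)
open import Data.Rational.Properties
  using (toℚᵘ-fromℚᵘ; toℚᵘ-cancel-≤; toℚᵘ-injective; toℚᵘ-homo-+; toℚᵘ-homo-*;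
         normalize-nonNeg; nonNeg+nonNeg⇒nonNeg; *-monoʳ-≤-nonNeg; module ≤-Reasoning)
open import Data.Rational.Unnormalised as ℚᵘ using (mkℚᵘ; _≃_; *≡*; *≤*)
import Data.Rational.Unnormalised.Properties as ℚᵘ
open import Relation.Binary.PropositionalEquality using (_≡_; cong)

fromℕ : ℕ → ℚ
fromℕ m = (+ m) /ℚ 1

toℚᵘ-fromℕ : ∀ m → toℚᵘ (fromℕ m) ≃ mkℚᵘ (+ m) 0
toℚᵘ-fromℕ m = toℚᵘ-fromℚᵘ (mkℚᵘ (+ m) 0)

fromℕ-mono-≤ : ∀ {m n} → m ≤ n → fromℕ m ≤ℚ fromℕ n
fromℕ-mono-≤ {m} {n} m≤n = toℚᵘ-cancel-≤ (begin
  toℚᵘ (fromℕ m)    ≃⟨ toℚᵘ-fromℕ m ⟩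
  mkℚᵘ (+ m) 0      ≤⟨ *≤* (ℤ.*-monoʳ-≤-nonNeg (+ 1) (+≤+ m≤n)) ⟩
  mkℚᵘ (+ n) 0      ≃⟨ toℚᵘ-fromℕ n ⟨
  toℚᵘ (fromℕ n)    ∎)
  where open ℚᵘ.≤-Reasoning

invPred-nonNeg : ∀ n → NonNegative (invPred n)
invPred-nonNeg 0             = _
invPred-nonNeg 1             = _
invPred-nonNeg (suc (suc k)) = normalize-nonNeg 1 (suc k)

1+invPred-nonNeg : ∀ n → NonNegative (1ℚ + invPred n)
1+invPred-nonNeg n = nonNeg+nonNeg⇒nonNeg 1ℚ (invPred n) {{invPred-nonNeg n}}

[q∸1]*[1+invPred-q]≡q : ∀ q → 2 ≤ q → fromℕ (q ∸ 1) * (1ℚ + invPred q) ≡ fromℕ q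
[q∸1]*[1+invPred-q]≡q (suc (suc k)) (s≤s (s≤s z≤n)) = toℚᵘ-injective (begin
  toℚᵘ (fromℕ (suc k) * (1ℚ + 1/[k+1]))
    ≈⟨ toℚᵘ-homo-* (fromℕ (suc k)) (1ℚ + 1/[k+1]) ⟩
  toℚᵘ (fromℕ (suc k)) ℚᵘ.* toℚᵘ (1ℚ + 1/[k+1])
    ≈⟨ ℚᵘ.*-cong (toℚᵘ-fromℕ (suc k)) (toℚᵘ-homo-+ 1ℚ 1/[k+1]) ⟩
  mkℚᵘ (+ suc k) 0 ℚᵘ.* (toℚᵘ 1ℚ ℚᵘ.+ toℚᵘ 1/[k+1])
    ≈⟨ ℚᵘ.*-congˡ (ℚᵘ.+-congʳ (toℚᵘ 1ℚ) (toℚᵘ-fromℚᵘ (mkℚᵘ (+ 1) k))) ⟩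
  mkℚᵘ (+ suc k) 0 ℚᵘ.* (mkℚᵘ (+ 1) 0 ℚᵘ.+ mkℚᵘ (+ 1) k)
    ≈⟨ *≡* (cong (λ x → + suc x) (solve (k ∷ []))) ⟩
  mkℚᵘ (+ suc (suc k)) 0
    ≈⟨ toℚᵘ-fromℕ (suc (suc k)) ⟨
  toℚᵘ (fromℕ (suc (suc k))) ∎)
  where
  open ℚᵘ.≃-Reasoning
  1/[k+1] : ℚ
  1/[k+1] = invPred (suc (suc k))

*[1+invPred]-≤-pred : ∀ {x} q r → 2 ≤ q → q < r → x ≤ℚ fromℕ (q ∸ 1) →
                      x * (1ℚ + invPred q) ≤ℚ fromℕ (r ∸ 1)
*[1+invPred]-≤-pred {x} q r 2≤q q<r x≤q-1 = begin
  x * (1ℚ + invPred q)             ≤⟨ *-monoʳ-≤-nonNeg (1ℚ + invPred q) {{1+invPred-nonNeg q}} x≤q-1 ⟩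
  fromℕ (q ∸ 1) * (1ℚ + invPred q) ≡⟨ [q∸1]*[1+invPred-q]≡q q 2≤q ⟩
  fromℕ q                          ≤⟨ fromℕ-mono-≤ (∸-monoˡ-≤ 1 q<r) ⟩
  fromℕ (r ∸ 1)                    ∎
  where open ≤-Reasoning

prod1[1+invPred]≤pred : (p : ℕ → ℕ) → (∀ i → 2 ≤ p (suc i)) → (∀ i → p (suc i) < p (suc (suc i))) →
  ∀ ℓ → prod1 (λ i → 1ℚ + invPred (p i)) ℓ ≤ℚ fromℕ (p (suc ℓ) ∸ 1)
prod1[1+invPred]≤pred p p≥2 p-increasing 0       = fromℕ-mono-≤ (∸-monoˡ-≤ 1 (p≥2 0))
prod1[1+invPred]≤pred p p≥2 p-increasing (suc ℓ) =
  *[1+invPred]-≤-pred (p (suc ℓ)) (p (suc (suc ℓ))) (p≥2 ℓ) (p-increasing ℓ)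
    (prod1[1+invPred]≤pred p p≥2 p-increasing ℓ)

lemma14 : (p : ℕ → ℕ) → IsPrimeEnumeration p → (ℓ : ℕ) → 1 ≤ ℓ →
    prod1 (λ i → 1ℚ + invPred (p i)) ℓ ≤ℚ (+ (p (suc ℓ) ∸ 1)) /ℚ 1
lemma14 p enum ℓ _ = prod1[1+invPred]≤pred p p≥2 p-increasing ℓ
  where
  open IsPrimeEnumeration enum
  p≥2 : ∀ i → 2 ≤ p (suc i)
  p≥2 i = nonTrivial⇒n>1 _ {{prime⇒nonTrivial (prime (suc i) (s≤s z≤n))}}
  p-increasing : ∀ i → p (suc i) < p (suc (suc i))
  p-increasing i = strictMono (suc i) (suc (suc i)) (s≤s z≤n) (n<1+n (suc i))
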